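{- Let $r \ge 3$, $t \ge 1$, and let $H_t$ be a member of $\mathcal H_t$ (defined in the context), with distinguished vertices $v_1, \dots, v_t$ and vertex sets $V_0 \subset V_1 \subset \dots \subset V_t = V(H_t)$. Consider the $K_r$-bootstrap percolation process started from $H_t$ (on the complete graph with vertex set $V(H_t)$). Then: (a) for every vertex $u \in V_{t-2}$ (where $V_{ -1} := \emptyset$), the edge $\{u, v_t\}$ either belongs to $H_t$ or is activated precisely at time $t$; (b) for every $0 \le s \le t$, at time $s$ the set $V_s$ induces a complete graph, i.e. $\langle H_t \rangle_s[V_s] \cong K_{r-1+s}$.
   Context: $K_r$-bootstrap percolation: starting from a graph $G$ on vertex set $V$, set $G_0 := G$ and $G_{t+1} := G_t \cup \{e \in \binom{V}{2} : e \text{ is the only edge missing from } G_t \text{ in some copy of } K_r\}$; write $\langle G \rangle_t := G_t$. The family $\mathcal H_t$ is defined recursively together with graphs $H_s$ on vertex sets $V_s$. The body $H_0$ is a clique $K_{r-1}$ on vertex set $V_0$. $\mathcal H_1 = \{K_r - e\}$: $H_1$ consists of $H_0$ together with a new vertex $v_1$ adjacent to exactly $r-2$ vertices of $V_0$, and $v_0$ denotes a vertex of $V_0$ adjacent to $v_1$. For $t \ge 2$, a graph $H_t \in \mathcal H_t$ has vertex set $V_t = V_{t-1} \cup \{v_t\}$ with $v_t$ a new vertex, and satisfies: (i) $H_t[V_{t-1}] = H_{t-1}$ for some $H_{t-1} \in \mathcal H_{t-1}$ (with its own distinguished vertices $v_1,\dots,v_{t-1}$); (ii) $v_{t-1} \in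 N(v_t)$; (iii) $|N(v_t)| = r-2$; (iv) $N(v_t) \setminus \{v_{t-1}\} \not\subseteq N(v_{t-1})$. Here neighbourhoods are taken in $H_t$. Such a graph has $r-1+t$ vertices and $\binom{r-1}{2} + t(r-2)$ edges. -}

module Defs where

open import Data.Nat using (ℕ; zero; suc; _+_; _∸_; _≤_; _<_; _<ᵇ_)
open import Data.Bool using (Bool; true; false; T; _∧_)
open import Data.Fin using (Fin; toℕ)
open import Data.List using (length; filter)
open import Data.Product using (Σ; ∃; _×_; _,_)
open import Data.Sum using (_⊎_)
open import Relation.Nullary using (¬_)
open import Relation.Nullary.Decidable.Core using (T?)
open import Relation.Binary.PropositionalEquality using (_≡_; _≢_)
open import Function.Definitions using (Injective)
import Data.List as L

record Graph (n : ℕ) : Set where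
  field
    adj    : Fin n → Fin n → Bool
    sym    : ∀ x y → adj x y ≡ adj y x
    irrefl : ∀ x → adj x x ≡ false
open Graph public

degBelow : ∀ {n} → Graph n → Fin n → ℕ → ℕ
degBelow {n} G x m =
  length (filter (λ j → T? ((toℕ j <ᵇ m) ∧ adj G x j)) (L.allFin n))

-- Labelling convention (r ≥ 3, k = r - 1):
--   V_s  = vertices with label < r ∸ 1 + s          (so V_0 is the body K_{r-1})
--   v_s  = the vertex with label r ∸ 2 + s          (1 ≤ s ≤ t)
-- so that V_s = V_{s-1} ∪ {v_s} and H_s = H_t[V_s].
InV : (r s : ℕ) → ∀ {n} → Fin n → Set
InV r s x = toℕ x < r ∸ 1 + s

IsV : (r s : ℕ) → ∀ {n} → Fin n → Set
IsV r s x = toℕ x ≡ r ∸ 2 + s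

record InFamily (r t : ℕ) (G : Graph (r ∸ 1 + t)) : Set where
  field
    body     : ∀ x y → InV r 0 x → InV r 0 y → x ≢ y → T (adj G x y)
    -- (iii) in H_s, v_s has exactly r-2 neighbours (all in V_{s-1})
    degree   : ∀ s x → 1 ≤ s → s ≤ t → IsV r s x →
               degBelow G x (r ∸ 2 + s) ≡ r ∸ 2
    linked   : ∀ s x y → 2 ≤ s → s ≤ t → IsV r s x → IsV r (s ∸ 1) y →
               T (adj G x y)
    -- (iv) N(v_s) ∖ {v_{s-1}} ⊈ N(v_{s-1}) (neighbourhoods in H_s) for s ≥ 2
    notSub   : ∀ s x y → 2 ≤ s → s ≤ t → IsV r s x → IsV r (s ∸ 1) y →
               ∃ λ u → InV r s u × u ≢ x × u ≢ y × T (adj G x u) × ¬ T (adj G y u)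

SameEdge : ∀ {n} → Fin n → Fin n → Fin n → Fin n → Set
SameEdge a b x y = (a ≡ x × b ≡ y) ⊎ (a ≡ y × b ≡ x)

-- K_r-bootstrap percolation: Cl r G s x y  means  xy ∈ ⟨G⟩_s.
Cl : (r : ℕ) → ∀ {n} → Graph n → ℕ → Fin n → Fin n → Set
Cl r G zero x y = T (adj G x y)
Cl r {n} G (suc s) x y =
  Cl r G s x y ⊎
  (x ≢ y × Σ (Fin r → Fin n) λ f → Injective _≡_ _≡_ f ×
     (∃ λ a → f a ≡ x) × (∃ λ b → f b ≡ y) ×
     (∀ a b → a ≢ b → SameEdge (f a) (f b) x y ⊎ Cl r G s (f a) (f b)))

-- The vertices are labelled so that each V_s is an initial segment and v_j directly
-- follows V_{j-1}.
-- Confinement: every edge of ⟨H_t⟩_s that is not in H_t lies inside V_s.  In a copy of K_r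
-- activating xy with y outside V_{s+1}, the vertex of largest label must be y: otherwise that
-- vertex is some v_j outside V_s and would have r - 1 earlier neighbours in H_t, not r - 2.
-- So the r - 2 remaining vertices of the copy are exactly the earlier neighbours of y = v_j;
-- among them are v_{j-1} and the vertex u given by (iv), and the copy edge v_{j-1}u is then
-- neither in H_t nor inside V_s.
-- Completeness: at time s + 1, v_{s+1} together with its r - 2 earlier neighbours and any other
-- x ∈ V_s spans a K_r missing only the edge x v_{s+1}.
-- Part (a) combines the two: u v_t is present at time t, but by confinement not at time t - 1.

module Submission where

open import Defs hiding (sym)
open import Data.Nat using (ℕ; zero; suc; z≤n; _+_; _∸_; _≤_; _<_; _<ᵇ_; s≤s; _<?_)
open import Data.Nat.Properties
  using (≤-refl; ≤-reflexive; ≤-trans; ≤-<-trans; ≤-antisym; ≤-pred; n≤1+n; <-trans; <-≤-trans;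
         <-cmp; <⇒≤; <⇒≱; ≮⇒≥; ≤∧≢⇒<; 1+n≰n; <-irrefl; <ᵇ⇒<; <⇒<ᵇ; +-suc; m≤m+n; m∸n≤m;
         ∸-monoʳ-<; m+[n∸m]≡n; +-monoʳ-≤; +-monoʳ-<; +-cancelˡ-≤; +-cancelˡ-<)
open import Data.Bool using (Bool; T; _∧_)
open import Data.Bool.Properties using (T-∧)
open import Data.Fin using (Fin; zero; suc; toℕ; fromℕ<; punchIn; punchOut)
open import Data.Fin.Properties
  using (toℕ-injective; toℕ-fromℕ<; toℕ<n; _≟_; any?; injective⇒≤; punchIn-injective;
         punchInᵢ≢i; punchIn-punchOut)
open import Data.Vec.Functional using (_∷_)
open import Data.List using (List; length; filter; lookup; allFin)
open import Data.List.Membership.Propositional using (_∈_)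
open import Data.List.Membership.Propositional.Properties
  using (∈-filter⁺; ∈-filter⁻; ∈-allFin; ∈-lookup)
open import Data.List.Relation.Unary.Any using (index)
open import Data.List.Relation.Unary.Any.Properties using (lookup-index)
import Data.List.Relation.Unary.All as All
import Data.List.Relation.Unary.AllPairs as AllPairs
open import Data.List.Relation.Unary.Unique.Propositional using (Unique)
open import Data.List.Relation.Unary.Unique.Propositional.Properties using (filter⁺; allFin⁺)
open import Data.List.Extrema.Nat using (argmax; f[xs]≤f[argmax])
open import Data.Product using (Σ; ∃; ∃₂; _×_; _,_; proj₁; proj₂)
import Data.Product as Product
open import Data.Sum using (_⊎_; inj₁; inj₂; [_,_]′; map₁; map₂; swap)
import Data.Sum as Sum
open import Data.Empty using (⊥; ⊥-elim)
open import Relation.Nullary using (¬_; yes; no)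
open import Relation.Nullary.Decidable.Core using (T?)
open import Relation.Binary.PropositionalEquality
  using (_≡_; _≢_; refl; sym; trans; cong; subst; subst₂; module ≡-Reasoning)
open import Relation.Binary using (tri<; tri≈; tri>)
open import Function using (_∘_; Equivalence)
open import Function.Definitions using (Injective)

private
  variable
    k n : ℕ
    A : Set

∷-injective : ∀ {w : A} {g : Fin k → A} → Injective _≡_ _≡_ g → (∀ a → g a ≢ w) →
              Injective _≡_ _≡_ (w ∷ g)
∷-injective _     _     {zero}  {zero}  _  = refl
∷-injective _     fresh {zero}  {suc b} eq = ⊥-elim (fresh b (sym eq))
∷-injective _     fresh {suc a} {zero}  eq = ⊥-elim (fresh a eq)
∷-injective g-inj _     {suc a} {suc b} eq = cong suc (g-inj eq)

lookup-injective : ∀ {xs : List A} → Unique xs → Injective _≡_ _≡_ (lookup xs)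
lookup-injective (_  AllPairs.∷ _) {zero}  {zero}  _  = refl
lookup-injective (px AllPairs.∷ _) {zero}  {suc j} eq = ⊥-elim (All.lookup px (∈-lookup j) eq)
lookup-injective (px AllPairs.∷ _) {suc i} {zero}  eq = ⊥-elim (All.lookup px (∈-lookup i) (sym eq))
lookup-injective (_  AllPairs.∷ u) {suc i} {suc j} eq = cong suc (lookup-injective u eq)

punchIn₂ : {i j : Fin (suc (suc n))} → i ≢ j → Fin n → Fin (suc (suc n))
punchIn₂ {i = i} i≢j = punchIn i ∘ punchIn (punchOut i≢j)

punchIn₂-injective : {i j : Fin (suc (suc n))} (i≢j : i ≢ j) → Injective _≡_ _≡_ (punchIn₂ i≢j)
punchIn₂-injective {i = i} i≢j =
  punchIn-injective (punchOut i≢j) _ _ ∘ punchIn-injective i _ _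

punchIn₂≢i : {i j : Fin (suc (suc n))} (i≢j : i ≢ j) → ∀ a → punchIn₂ i≢j a ≢ i
punchIn₂≢i {i = i} i≢j a = punchInᵢ≢i i _

punchIn₂≢j : {i j : Fin (suc (suc n))} (i≢j : i ≢ j) → ∀ a → punchIn₂ i≢j a ≢ j
punchIn₂≢j {i = i} i≢j a eq =
  punchInᵢ≢i (punchOut i≢j) a (punchIn-injective i _ _ (trans eq (sym (punchIn-punchOut i≢j))))

module _ (P : Fin n → Bool) where

  private
    selected : List (Fin n)
    selected = filter (λ z → T? (P z)) (allFin n)

  injection⇒≤count : (g : Fin k → Fin n) → Injective _≡_ _≡_ g → (∀ a → T (P (g a))) →
                     k ≤ length selected
  injection⇒≤count g g-inj Pg = injective⇒≤ index-injective
    where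
    member : ∀ a → g a ∈ selected
    member a = ∈-filter⁺ (λ z → T? (P z)) (∈-allFin (g a)) (Pg a)

    index-injective : Injective _≡_ _≡_ (λ a → index (member a))
    index-injective {a} {b} eq = g-inj (begin
      g a                               ≡⟨ lookup-index (member a) ⟩
      lookup selected (index (member a)) ≡⟨ cong (lookup selected) eq ⟩
      lookup selected (index (member b)) ≡⟨ sym (lookup-index (member b)) ⟩
      g b                               ∎)
      where open ≡-Reasoning

  enumerate : Σ (Fin (length selected) → Fin n) λ e → Injective _≡_ _≡_ e × (∀ i → T (P (e i)))
  enumerate = lookup selected
            , lookup-injective (filter⁺ (λ z → T? (P z)) (allFin⁺ n))
            , λ i → proj₂ (∈-filter⁻ (λ z → T? (P z)) {xs = allFin n} (∈-lookup i))

  injection-covers : (g : Fin k → Fin n) → Injective _≡_ _≡_ g → (∀ a → T (P (g a))) →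
                     length selected ≤ k → ∀ {w} → T (P w) → ∃ λ a → g a ≡ w
  injection-covers g g-inj Pg count≤k {w} Pw with any? (λ a → g a ≟ w)
  ... | yes hit = hit
  ... | no miss =
    ⊥-elim (1+n≰n (≤-trans (injection⇒≤count (w ∷ g) w∷g-injective Pw∷g) count≤k))
    where
    w∷g-injective : Injective _≡_ _≡_ (w ∷ g)
    w∷g-injective = ∷-injective g-inj (λ a eq → miss (a , eq))

    Pw∷g : ∀ a → T (P ((w ∷ g) a))
    Pw∷g zero    = Pw
    Pw∷g (suc a) = Pg a

argmax-Fin : (h : Fin (suc k) → ℕ) → ∃ λ i → ∀ a → h a ≤ h i
argmax-Fin h = argmax h zero (allFin _)
             , λ a → All.lookup (f[xs]≤f[argmax] {f = h} zero (allFin _)) (∈-allFin a)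

Adjacent : Graph n → Fin n → Fin n → Set
Adjacent G x y = T (adj G x y)

Adjacent-sym : ∀ (G : Graph n) {x y} → Adjacent G x y → Adjacent G y x
Adjacent-sym G {x} {y} = subst T (Graph.sym G x y)

Adjacent-irrefl : ∀ (G : Graph n) {x} → ¬ Adjacent G x x
Adjacent-irrefl G {x} = subst T (irrefl G x)

NeighbourBelow : Graph n → Fin n → ℕ → Fin n → Set
NeighbourBelow G x m z = toℕ z < m × Adjacent G x z

module _ (G : Graph n) (x : Fin n) (m : ℕ) where

  private
    P : Fin n → Bool
    P z = (toℕ z <ᵇ m) ∧ adj G x z

    to-T : ∀ {z} → NeighbourBelow G x m z → T (P z)
    to-T (z<m , xz) = Equivalence.from T-∧ (<⇒<ᵇ z<m , xz)

    from-T : ∀ {z} → T (P z) → NeighbourBelow G x m z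
    from-T {z} Pz = Product.map₁ (<ᵇ⇒< (toℕ z) m) (Equivalence.to T-∧ Pz)

  degBelow-≥ : (g : Fin k → Fin n) → Injective _≡_ _≡_ g →
               (∀ a → NeighbourBelow G x m (g a)) → k ≤ degBelow G x m
  degBelow-≥ g g-inj below = injection⇒≤count P g g-inj (to-T ∘ below)

  neighboursBelow : Σ (Fin (degBelow G x m) → Fin n) λ e →
                    Injective _≡_ _≡_ e × (∀ i → NeighbourBelow G x m (e i))
  neighboursBelow = Product.map₂ (Product.map₂ (from-T ∘_)) (enumerate P)

  neighboursBelow-covered : (g : Fin k → Fin n) → Injective _≡_ _≡_ g →
                            (∀ a → NeighbourBelow G x m (g a)) → degBelow G x m ≤ k →
                            ∀ {w} → NeighbourBelow G x m w → ∃ λ a → g a ≡ w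
  neighboursBelow-covered g g-inj below deg≤k =
    injection-covers P g g-inj (to-T ∘ below) deg≤k ∘ to-T

SameEdge-sym : ∀ {a b x y : Fin n} → SameEdge a b x y → SameEdge a b y x
SameEdge-sym = swap

SameEdge-endpointˡ : ∀ {a b x y : Fin n} → SameEdge a b x y → a ≡ x ⊎ a ≡ y
SameEdge-endpointˡ = Sum.map proj₁ proj₁

SameEdge-endpointʳ : ∀ {a b x y : Fin n} → SameEdge a b x y → b ≡ y ⊎ b ≡ x
SameEdge-endpointʳ = Sum.map proj₂ proj₂

ActivatingCopy : (r : ℕ) → Graph n → ℕ → Fin n → Fin n → (Fin r → Fin n) → Set
ActivatingCopy r G s x y f =
  Injective _≡_ _≡_ f × (∃ λ a → f a ≡ x) × (∃ λ b → f b ≡ y) ×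
  (∀ a b → a ≢ b → SameEdge (f a) (f b) x y ⊎ Cl r G s (f a) (f b))

module _ {r : ℕ} {G : Graph n} where

  Adjacent⇒Cl : ∀ s {x y} → Adjacent G x y → Cl r G s x y
  Adjacent⇒Cl zero    xy = xy
  Adjacent⇒Cl (suc s) xy = inj₁ (Adjacent⇒Cl s xy)

  ActivatingCopy-sym : ∀ {s x y f} → ActivatingCopy r G s x y f → ActivatingCopy r G s y x f
  ActivatingCopy-sym (f-inj , x∈f , y∈f , pairs) = f-inj , y∈f , x∈f , λ a b a≢b →
    map₁ SameEdge-sym (pairs a b a≢b)

  Cl-sym : ∀ s {x y} → Cl r G s x y → Cl r G s y x
  Cl-sym zero    xy                          = Adjacent-sym G xy
  Cl-sym (suc s) (inj₁ xy)                   = inj₁ (Cl-sym s xy)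
  Cl-sym (suc s) (inj₂ (x≢y , f , copy)) = inj₂ (x≢y ∘ sym , f , ActivatingCopy-sym {s = s} copy)

module Family (r₀ t : ℕ) (G : Graph (2 + r₀ + t)) (H : InFamily (3 + r₀) t G) where

  open InFamily H

  r : ℕ
  r = 3 + r₀

  V : Set
  V = Fin (2 + r₀ + t)

  InV-mono : ∀ {s s′} {x : V} → s ≤ s′ → InV r s x → InV r s′ x
  InV-mono s≤s′ x∈ = <-≤-trans x∈ (+-monoʳ-≤ (2 + r₀) s≤s′)

  IsV⇒∉ : ∀ {j s} {x : V} → IsV r j x → s < j → ¬ InV r s x
  IsV⇒∉ {j} {s} x≡ s<j x∈ =
    <⇒≱ (+-monoʳ-< (suc r₀) s<j) (subst (_≤ suc r₀ + s) x≡ (≤-pred x∈))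

  ∉⇒IsV : ∀ {s} {x : V} → ¬ InV r s x → ∃ λ j → s < j × j ≤ t × IsV r j x
  ∉⇒IsV {s} {x} x∉ = toℕ x ∸ suc r₀ , s<j , j≤t , sym x≡
    where
    x≡ : suc r₀ + (toℕ x ∸ suc r₀) ≡ toℕ x
    x≡ = m+[n∸m]≡n (≤-trans (m≤m+n (suc r₀) s) (<⇒≤ (≮⇒≥ x∉)))

    s<j : s < toℕ x ∸ suc r₀
    s<j = +-cancelˡ-< (suc r₀) _ _ (subst (suc r₀ + s <_) (sym x≡) (≮⇒≥ x∉))

    j≤t : toℕ x ∸ suc r₀ ≤ t
    j≤t = +-cancelˡ-≤ (suc r₀) _ _ (≤-pred (subst (_< 2 + r₀ + t) (sym x≡) (toℕ<n x)))

  InV-suc-split : ∀ {s} {x : V} → InV r (suc s) x → InV r s x ⊎ IsV r (suc s) x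
  InV-suc-split {s} {x} x∈ with toℕ x <? 2 + r₀ + s
  ... | yes x∈′ = inj₁ x∈′
  ... | no  x∉′ =
    inj₂ (≤-antisym (≤-pred x∈) (subst (_≤ toℕ x) (cong suc (sym (+-suc r₀ s))) (≮⇒≥ x∉′)))

  below-new⇒InV : ∀ {s} {v z : V} → IsV r (suc s) v → toℕ z < toℕ v → InV r s z
  below-new⇒InV {s} v≡ z<v = subst (_ <_) (trans v≡ (+-suc (suc r₀) s)) z<v

  vertex : ∀ j → j ≤ t → Σ V (IsV r j)
  vertex j j≤t = fromℕ< j<n , toℕ-fromℕ< j<n
    where
    j<n : suc r₀ + j < 2 + r₀ + t
    j<n = s≤s (s≤s (+-monoʳ-≤ r₀ j≤t))

  degBelow-outside : ∀ {s} {w : V} → ¬ InV r s w → degBelow G w (toℕ w) ≡ suc r₀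
  degBelow-outside {w = w} w∉ =
    let j , s<j , j≤t , w≡ = ∉⇒IsV w∉ in
    subst (λ m → degBelow G w m ≡ suc r₀) (sym w≡) (degree j w (≤-trans (s≤s z≤n) s<j) j≤t w≡)

  neighboursBelow-outside-bound : ∀ {s} {w : V} → ¬ InV r s w →
    (g : Fin (2 + r₀) → V) → Injective _≡_ _≡_ g → ¬ (∀ a → NeighbourBelow G w (toℕ w) (g a))
  neighboursBelow-outside-bound {w = w} w∉ g g-inj below =
    1+n≰n (subst (2 + r₀ ≤_) (degBelow-outside w∉) (degBelow-≥ G w (toℕ w) g g-inj below))

  neighboursBelow-outside : ∀ {s} {w : V} → ¬ InV r s w → Σ (Fin (suc r₀) → V) λ e →
    Injective _≡_ _≡_ e × (∀ i → NeighbourBelow G w (toℕ w) (e i))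
  neighboursBelow-outside {w = w} w∉ =
    subst (λ d → Σ (Fin d → V) λ e →
                   Injective _≡_ _≡_ e × (∀ i → NeighbourBelow G w (toℕ w) (e i)))
          (degBelow-outside w∉) (neighboursBelow G w (toℕ w))

  neighboursBelow-outside-covered :
    ∀ {s} {w : V} → ¬ InV r s w → (g : Fin (suc r₀) → V) → Injective _≡_ _≡_ g →
    (∀ a → NeighbourBelow G w (toℕ w) (g a)) →
    ∀ {z} → NeighbourBelow G w (toℕ w) z → ∃ λ a → g a ≡ z
  neighboursBelow-outside-covered {w = w} w∉ g g-inj below =
    neighboursBelow-covered G w (toℕ w) g g-inj below (≤-reflexive (degBelow-outside w∉))

  nonadjacent-neighboursBelow : ∀ {j} {y : V} → 1 ≤ j → suc j ≤ t → IsV r (suc j) y →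
    ∃₂ λ p u → NeighbourBelow G y (toℕ y) p × NeighbourBelow G y (toℕ y) u ×
               p ≢ u × ¬ Adjacent G p u × IsV r j p
  nonadjacent-neighboursBelow {j} {y} 1≤j j<t y≡ with vertex j (≤-trans (n≤1+n j) j<t)
  ... | p , p≡ with notSub (suc j) y p (s≤s 1≤j) j<t y≡ p≡
  ...   | u , u∈ , u≢y , u≢p , y∼u , p≁u =
    p , u , (p<y , linked (suc j) y p (s≤s 1≤j) j<t y≡ p≡) , (u<y , y∼u) ,
    u≢p ∘ sym , p≁u , p≡
    where
    p<y : toℕ p < toℕ y
    p<y = subst₂ _<_ (sym p≡) (sym y≡) (+-monoʳ-< (suc r₀) ≤-refl)

    u<y : toℕ u < toℕ y
    u<y = ≤∧≢⇒< (subst (toℕ u ≤_) (sym y≡) (≤-pred u∈)) (u≢y ∘ toℕ-injective)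

  Confined : ℕ → Set
  Confined s = ∀ {x y} → Cl r G s x y → Adjacent G x y ⊎ (InV r s x × InV r s y)

  module Activation
    {s} (IH : Confined s) {x y : V} {f : Fin r → V} (f-inj : Injective _≡_ _≡_ f)
    {ax ay} (fax : f ax ≡ x) (fay : f ay ≡ y)
    (pairs : ∀ a b → a ≢ b → SameEdge (f a) (f b) x y ⊎ Cl r G s (f a) (f b))
    (x≁y : ¬ Adjacent G x y) (x<y : toℕ x < toℕ y) (y∉ : ¬ InV r (suc s) y)
    where

    y∉′ : ¬ InV r s y
    y∉′ = y∉ ∘ InV-mono (n≤1+n s)

    ax≢ay : ax ≢ ay
    ax≢ay ax≡ay = <-irrefl (cong toℕ (trans (sym fax) (trans (cong f ax≡ay) fay))) x<y

    copy-edge-outside : ∀ {a b} → a ≢ b → ¬ SameEdge (f a) (f b) x y → ¬ InV r s (f a) →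
                     Adjacent G (f a) (f b)
    copy-edge-outside {a} {b} a≢b not-xy fa∉ with pairs a b a≢b
    ... | inj₁ xy  = ⊥-elim (not-xy xy)
    ... | inj₂ old with IH old
    ...   | inj₁ fa∼fb      = fa∼fb
    ...   | inj₂ (fa∈ , _) = ⊥-elim (fa∉ fa∈)

    -- Otherwise the top vertex of the copy, a v_j outside V_s, has r - 1 lower neighbours in G.
    maximum≡y : ∀ {m} → (∀ a → toℕ (f a) ≤ toℕ (f m)) → f m ≡ y
    maximum≡y {m} below-m with f m ≟ y
    ... | yes m≡y = m≡y
    ... | no  m≢y = ⊥-elim
      (neighboursBelow-outside-bound m∉ (f ∘ punchIn m) (punchIn-injective m _ _ ∘ f-inj) below)
      where
      y≤m : toℕ y ≤ toℕ (f m)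
      y≤m = subst (λ z → toℕ z ≤ toℕ (f m)) fay (below-m ay)

      m∉ : ¬ InV r s (f m)
      m∉ m∈ = y∉′ (≤-<-trans y≤m m∈)

      m≢x : f m ≢ x
      m≢x m≡x = <⇒≱ x<y (subst (λ z → toℕ y ≤ toℕ z) m≡x y≤m)

      below : ∀ a → NeighbourBelow G (f m) (toℕ (f m)) (f (punchIn m a))
      below a = ≤∧≢⇒< (below-m _) (punchInᵢ≢i m a ∘ f-inj ∘ toℕ-injective)
              , copy-edge-outside (punchInᵢ≢i m a ∘ sym)
                                  ([ m≢x , m≢y ]′ ∘ SameEdge-endpointˡ) m∉

    below-y : ∀ {a} → a ≢ ay → toℕ (f a) < toℕ y
    below-y {a} a≢ay = ≤∧≢⇒< a≤y (λ eq → a≢ay (f-inj (trans (toℕ-injective eq) (sym fay))))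
      where
      a≤y : toℕ (f a) ≤ toℕ y
      a≤y = let m , below-m = argmax-Fin (toℕ ∘ f)
            in subst (λ z → toℕ (f a) ≤ toℕ z) (maximum≡y below-m) (below-m a)

    others : Fin (suc r₀) → Fin r
    others = punchIn₂ ax≢ay

    others-below-y : ∀ i → NeighbourBelow G y (toℕ y) (f (others i))
    others-below-y i =
      below-y (punchIn₂≢j ax≢ay i) , subst (λ z → Adjacent G z (f (others i))) fay y∼
      where
      not-xy : ¬ SameEdge (f ay) (f (others i)) x y
      not-xy = [ punchIn₂≢j ax≢ay i ∘ f-inj ∘ (λ eq → trans eq (sym fay))
               , punchIn₂≢i ax≢ay i ∘ f-inj ∘ (λ eq → trans eq (sym fax)) ]′ ∘ SameEdge-endpointʳ

      y∼ : Adjacent G (f ay) (f (others i))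
      y∼ = copy-edge-outside (punchIn₂≢j ax≢ay i ∘ sym) not-xy (y∉′ ∘ subst (InV r s) fay)

    -- The copy already contains r - 2 lower neighbours of y, which are all of them.
    neighbourBelow-y-in-copy : ∀ {z} → NeighbourBelow G y (toℕ y) z → ∃ λ a → f a ≡ z
    neighbourBelow-y-in-copy z-below =
      let i , fi≡z = neighboursBelow-outside-covered y∉′ (f ∘ others)
                       (punchIn₂-injective ax≢ay ∘ f-inj) others-below-y z-below
      in others i , fi≡z

    copy-edge-below-y : ∀ {a b} → a ≢ b → NeighbourBelow G y (toℕ y) (f a) →
                        Adjacent G (f a) (f b) ⊎ InV r s (f a)
    copy-edge-below-y {a} {b} a≢b (a<y , y∼a) with pairs a b a≢b
    ... | inj₁ xy  = ⊥-elim ([ a≢x , a≢y ]′ (SameEdge-endpointˡ xy))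
      where
      a≢x : f a ≢ x
      a≢x fa≡x = x≁y (Adjacent-sym G (subst (Adjacent G y) fa≡x y∼a))

      a≢y : f a ≢ y
      a≢y fa≡y = <-irrefl (cong toℕ fa≡y) a<y
    ... | inj₂ old = map₂ proj₁ (IH old)

    neighboursBelow-y-joined : ∀ {p u} →
      NeighbourBelow G y (toℕ y) p → NeighbourBelow G y (toℕ y) u → p ≢ u →
      Adjacent G p u ⊎ InV r s p
    neighboursBelow-y-joined p-below u-below p≢u =
      let ap , fap≡p = neighbourBelow-y-in-copy p-below
          au , fau≡u = neighbourBelow-y-in-copy u-below
      in subst₂ (λ p u → Adjacent G p u ⊎ InV r s p) fap≡p fau≡u
           (copy-edge-below-y (λ ap≡au → p≢u (trans (sym fap≡p) (trans (cong f ap≡au) fau≡u)))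
                              (subst (NeighbourBelow G y (toℕ y)) (sym fap≡p) p-below))

    impossible : ⊥
    impossible with ∉⇒IsV y∉
    ... | suc j , s<j , j<t , y≡ =
      let p , u , p-below , u-below , p≢u , p≁u , p≡ =
            nonadjacent-neighboursBelow (≤-trans (s≤s z≤n) (≤-pred s<j)) j<t y≡
      in [ p≁u , IsV⇒∉ p≡ (≤-pred s<j) ]′ (neighboursBelow-y-joined p-below u-below p≢u)

  activated⇒InV : ∀ {s} → Confined s → ∀ {x y f} → ActivatingCopy r G s x y f →
                      ¬ Adjacent G x y → toℕ x < toℕ y → InV r (suc s) y
  activated⇒InV {s} IH {y = y} (f-inj , (_ , fax) , (_ , fay) , pairs) x≁y x<y
    with toℕ y <? 2 + r₀ + suc s
  ... | yes y∈ = y∈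
  ... | no  y∉ = ⊥-elim (Activation.impossible IH f-inj fax fay pairs x≁y x<y y∉)

  confined : ∀ s → Confined s
  confined zero    xy         = inj₁ xy
  confined (suc s) (inj₁ old) =
    map₂ (Product.map (InV-mono (n≤1+n s)) (InV-mono (n≤1+n s))) (confined s old)
  confined (suc s) {x} {y} (inj₂ (x≢y , f , copy)) with T? (adj G x y) | <-cmp (toℕ x) (toℕ y)
  ... | yes x∼y | _           = inj₁ x∼y
  ... | no  _   | tri≈ _ x≡y _ = ⊥-elim (x≢y (toℕ-injective x≡y))
  ... | no  x≁y | tri< x<y _ _ = inj₂ (<-trans x<y y∈ , y∈)
    where y∈ = activated⇒InV (confined s) copy x≁y x<y
  ... | no  x≁y | tri> _ _ y<x = inj₂ (x∈ , <-trans y<x x∈)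
    where
    x∈ = activated⇒InV (confined s) (ActivatingCopy-sym {s = s} copy) (x≁y ∘ Adjacent-sym G) y<x

  Complete : ℕ → Set
  Complete s = ∀ {x y} → InV r s x → InV r s y → x ≢ y → Cl r G s x y

  joins-new-vertex : ∀ {s} → Complete s → ∀ {x v} → InV r s x → IsV r (suc s) v →
                     Cl r G (suc s) x v
  joins-new-vertex {s} IH {x} {v} x∈ v≡ with T? (adj G x v) | neighboursBelow-outside (IsV⇒∉ v≡ ≤-refl)
  ... | yes x∼v | _ = Adjacent⇒Cl (suc s) x∼v
  ... | no  x≁v | e , e-inj , e-below =
    inj₂ (x≢v , f , ∷-injective (∷-injective e-inj v∉e) x∉v∷e ,
          (zero , refl) , (suc zero , refl) , pairs)
    where
    e∈ : ∀ i → InV r s (e i)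
    e∈ i = below-new⇒InV v≡ (proj₁ (e-below i))

    v∼e : ∀ i → Adjacent G v (e i)
    v∼e i = proj₂ (e-below i)

    v∉e : ∀ i → e i ≢ v
    v∉e i eq = Adjacent-irrefl G (subst (Adjacent G v) eq (v∼e i))

    x≢v : x ≢ v
    x≢v refl = IsV⇒∉ v≡ ≤-refl x∈

    x≢e : ∀ i → x ≢ e i
    x≢e i eq = x≁v (Adjacent-sym G (subst (Adjacent G v) (sym eq) (v∼e i)))

    x∉v∷e : ∀ a → (v ∷ e) a ≢ x
    x∉v∷e zero    = x≢v ∘ sym
    x∉v∷e (suc i) = x≢e i ∘ sym

    f : Fin r → V
    f = x ∷ v ∷ e

    pairs : ∀ a b → a ≢ b → SameEdge (f a) (f b) x v ⊎ Cl r G s (f a) (f b)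
    pairs zero          zero          a≢b = ⊥-elim (a≢b refl)
    pairs zero          (suc zero)    _   = inj₁ (inj₁ (refl , refl))
    pairs zero          (suc (suc j)) _   = inj₂ (IH x∈ (e∈ j) (x≢e j))
    pairs (suc zero)    zero          _   = inj₁ (inj₂ (refl , refl))
    pairs (suc zero)    (suc zero)    a≢b = ⊥-elim (a≢b refl)
    pairs (suc zero)    (suc (suc j)) _   = inj₂ (Adjacent⇒Cl s (v∼e j))
    pairs (suc (suc i)) zero          _   = inj₂ (IH (e∈ i) x∈ (x≢e i ∘ sym))
    pairs (suc (suc i)) (suc zero)    _   = inj₂ (Adjacent⇒Cl s (Adjacent-sym G (v∼e i)))
    pairs (suc (suc i)) (suc (suc j)) a≢b =
      inj₂ (IH (e∈ i) (e∈ j) (a≢b ∘ cong (λ k → suc (suc k)) ∘ e-inj))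

  complete : ∀ s → Complete s
  complete zero    x∈ y∈ x≢y = body _ _ x∈ y∈ x≢y
  complete (suc s) x∈ y∈ x≢y with InV-suc-split x∈ | InV-suc-split y∈
  ... | inj₁ x∈′ | inj₁ y∈′ = inj₁ (complete s x∈′ y∈′ x≢y)
  ... | inj₁ x∈′ | inj₂ y≡  = joins-new-vertex (complete s) x∈′ y≡
  ... | inj₂ x≡  | inj₁ y∈′ = Cl-sym (suc s) (joins-new-vertex (complete s) y∈′ x≡)
  ... | inj₂ x≡  | inj₂ y≡  = ⊥-elim (x≢y (toℕ-injective (trans x≡ (sym y≡))))

  activated-at-t : 2 ≤ t → ∀ {u v} → InV r (t ∸ 2) u → IsV r t v →
                   Adjacent G u v ⊎ (Cl r G t u v × ¬ Cl r G (t ∸ 1) u v)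
  activated-at-t 2≤t {u} {v} u∈ v≡ with T? (adj G u v)
  ... | yes u∼v = inj₁ u∼v
  ... | no  u≁v = inj₂ (complete t (InV-mono (m∸n≤m t 2) u∈) v∈ u≢v , not-before)
    where
    v∈ : InV r t v
    v∈ = subst (_< 2 + r₀ + t) (sym v≡) ≤-refl

    u≢v : u ≢ v
    u≢v refl = IsV⇒∉ v≡ (∸-monoʳ-< (s≤s z≤n) 2≤t) u∈

    not-before : ¬ Cl r G (t ∸ 1) u v
    not-before = [ u≁v , IsV⇒∉ v≡ t∸1<t ∘ proj₂ ]′ ∘ confined (t ∸ 1)
      where
      t∸1<t : t ∸ 1 < t
      t∸1<t = ∸-monoʳ-< (s≤s z≤n) (≤-trans (n≤1+n 1) 2≤t)

proposition1 : (r t : ℕ) → 3 ≤ r → 1 ≤ t →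
    (G : Graph (r ∸ 1 + t)) → InFamily r t G →
    ((u vt : Fin (r ∸ 1 + t)) → 2 ≤ t → InV r (t ∸ 2) u → IsV r t vt →
       T (adj G u vt) ⊎ (Cl r G t u vt × ¬ Cl r G (t ∸ 1) u vt))
    × ((s : ℕ) → s ≤ t → (x y : Fin (r ∸ 1 + t)) →
       InV r s x → InV r s y → x ≢ y → Cl r G s x y)
proposition1 (suc (suc (suc r₀))) t (s≤s (s≤s (s≤s z≤n))) _ G H =
  (λ _ _ 2≤t u∈ v≡ → activated-at-t 2≤t u∈ v≡) , (λ s _ _ _ → complete s)
  where open Family r₀ t G H
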